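{- Let $F$ be a graph of order $n$ with minimum degree $\delta\ge 2$, and let $G_1(F)$ be the graph defined as follows: its vertex set is the disjoint union $S\cup S'\cup\{x,y\}$ where $|S'|=n-\delta-1$ and $|S\cup S'|=(n-1)^2-1$; $S\cup S'$ induces a complete graph; each of $x$ and $y$ is adjacent to every vertex of $S$, and $x,y$ are adjacent neither to each other nor to any vertex of $S'$. Call $x,y$ the outer vertices and the vertices of $S\cup S'$ the inner vertices. Then $G_1(F)$ is $F$-WORM colorable, and in every $F$-WORM coloring of $G_1(F)$ the outer vertices $x$ and $y$ receive the same color, and this color appears on exactly $n-2$ inner vertices.
   Context: All graphs are finite and simple. For graphs $F$ and $G$, an $F$-WORM coloring of $G$ is an assignment of colors to the vertices of $G$ such that no subgraph of $G$ isomorphic to $F$ is monochromatic (all its vertices have the same color) or rainbow (its vertices have pairwise distinct colors). $G$ is $F$-WORM colorable if it has at least one $F$-WORM coloring. -}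

module Defs where

open import Data.Nat using (ℕ; zero; suc; _+_; _∸_; _^_; _≤_)
open import Data.Fin using (Fin; zero; suc; toℕ)
open import Data.Bool using (Bool; true; false)
open import Data.Sum using (_⊎_; inj₁; inj₂)
open import Data.Product using (Σ; _×_; ∃)
open import Data.Empty using (⊥)
open import Relation.Nullary using (¬_; Dec; yes; no)
open import Relation.Binary.PropositionalEquality using (_≡_; _≢_)
open import Function.Definitions using (Injective)

count : (k : ℕ) → (P : Fin k → Set) → ((i : Fin k) → Dec (P i)) → ℕ
count zero P d = 0
count (suc k) P d with d zero
... | yes _ = suc (count k (λ i → P (suc i)) (λ i → d (suc i)))
... | no  _ = count k (λ i → P (suc i)) (λ i → d (suc i))

record Graph (n : ℕ) : Set where
  field
    adj    : Fin n → Fin n → Bool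
    sym    : ∀ u v → adj u v ≡ adj v u
    irrefl : ∀ v → adj v v ≡ false
open Graph public

degree : ∀ {n} → Graph n → Fin n → ℕ
degree {n} F v = count n (λ u → adj F v u ≡ true) (λ u → Data.Bool._≟_ (adj F v u) true)
  where import Data.Bool

MinDegree : ∀ {n} → Graph n → ℕ → Set
MinDegree {n} F δ = (∀ v → δ ≤ degree F v) × (∃ λ v → degree F v ≡ δ)

Copy : ∀ {n} → Graph n → (V : Set) → (V → V → Set) → Set
Copy {n} F V GAdj = Σ (Fin n → V) λ f → Injective _≡_ _≡_ f × (∀ u v → adj F u v ≡ true → GAdj (f u) (f v))

Monochromatic : ∀ {n} {V : Set} → (V → ℕ) → (Fin n → V) → Set
Monochromatic c f = ∀ i j → c (f i) ≡ c (f j)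

Rainbow : ∀ {n} {V : Set} → (V → ℕ) → (Fin n → V) → Set
Rainbow c f = ∀ i j → i ≢ j → c (f i) ≢ c (f j)

IsWORM : ∀ {n} → (F : Graph n) → (V : Set) → (GAdj : V → V → Set) → (V → ℕ) → Set
IsWORM F V GAdj c = (C : Copy F V GAdj) →
  ¬ Monochromatic c (Data.Product.proj₁ C) × ¬ Rainbow c (Data.Product.proj₁ C)
  where import Data.Product

-- Inner vertices: Fin k with k = (n-1)^2 - 1;
-- the inner vertex i lies in S' iff toℕ i < n - δ - 1, otherwise in S
-- (so |S'| = n - δ - 1).

innerCount : ℕ → ℕ
innerCount n = (n ∸ 1) ^ 2 ∸ 1

G1V : ℕ → Set
G1V n = Fin (innerCount n) ⊎ Bool

InS : (n δ : ℕ) → Fin (innerCount n) → Set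
InS n δ i = n ∸ δ ∸ 1 ≤ toℕ i

G1Adj : (n δ : ℕ) → G1V n → G1V n → Set
G1Adj n δ (inj₁ i) (inj₁ j) = i ≢ j
G1Adj n δ (inj₁ i) (inj₂ _) = InS n δ i
G1Adj n δ (inj₂ _) (inj₁ j) = InS n δ j
G1Adj n δ (inj₂ _) (inj₂ _) = ⊥

outerX outerY : (n : ℕ) → G1V n
outerX n = inj₂ false
outerY n = inj₂ true

module Submission where

-- G₁(F) has inner vertices Fin N, N = (n - 1)² - 1, forming a clique; those of
-- index ≥ |S'| = n - δ - 1 form S, and the outer vertices x, y are adjacent
-- exactly to S.  Write m = n - 1.
--
-- Existence: colour inner vertex i by ⌊(i + 1)/m⌋ and x, y by 0.  Only m colours
-- occur, so no copy is rainbow; every colour class has at most m inner vertices,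
-- and an outer vertex of a monochromatic copy would need its ≥ δ neighbours in
-- S ∩ (class 0), which has δ - 1 vertices.
--
-- Necessity: any n inner vertices carry a copy of F, and so do any m inner
-- vertices together with an outer vertex (sending a vertex of degree δ outside
-- and ordering the rest so that its neighbours land in S).  In a WORM colouring
-- this bounds inner colour classes and rainbow sets by m, and by m - 1 when they
-- avoid the colour of an outer vertex.  A greedy argument turns small colour
-- classes into large rainbow subsets, and counting yields both claims.

open import Defs hiding (sym)
open import Data.Nat using (ℕ; _≤_; _∸_; _≟_)
open import Data.Product using (_×_; ∃)
open import Data.Sum using (inj₁)
open import Relation.Binary.PropositionalEquality using (_≡_)

open import Level using (0ℓ)
open import Data.Nat using (zero; suc; pred; _+_; _*_; _<_; z≤n; s≤s; _≤?_; NonZero; >-nonZero)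
open import Data.Nat.Properties
  using ( ≤-trans; ≤-reflexive; ≤-antisym; ≤-pred; ≰⇒>; <⇒≱; 1+n≰n; <-irrefl; <-trans; <-cmp
        ; ≤-<-trans; <-≤-trans; m≤n⇒m≤1+n; m≤m+n; m≤n+m; suc-injective; suc-pred
        ; +-comm; +-assoc; +-suc; +-cancelˡ-≡; +-cancelʳ-≤; +-cancelˡ-<; +-monoˡ-≤; +-monoˡ-<
        ; +-monoʳ-<; *-identityʳ; m+n∸m≡n; m∸n+n≡m; ∸-+-assoc; ∸-monoˡ-<; ∸-cancelʳ-≡
        ; module ≤-Reasoning )
open import Data.Nat.DivMod using (_/_; _%_; m/n*n≤m; m≡m%n+[m/n]*n; m%n<n; m<n*o⇒m/o<n)
open import Data.Nat.Tactic.RingSolver using (solve-∀)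
open import Data.Fin using (Fin; zero; suc; toℕ; fromℕ<; punchIn; punchOut)
import Data.Fin as Fin
import Data.Fin.Properties as Finₚ
open import Data.Bool using (Bool; true; false)
import Data.Bool as Bool
open import Data.Product using (Σ; _,_; proj₁; proj₂)
open import Data.Sum using (inj₂)
open import Data.Sum.Properties using (inj₁-injective)
open import Data.Unit using (tt)
open import Data.Empty using (⊥; ⊥-elim)
open import Relation.Nullary using (¬_; Dec; yes; no)
open import Relation.Unary using (Pred; Decidable; _⊆_; _∩_; _∪_; ∁; U; ∅; ｛_｝; _⟨⊎⟩_)
open import Relation.Unary.Properties using (_∩?_; _∪?_; ∁?; U?; ∅?)
open import Relation.Binary.PropositionalEquality using (_≢_; refl; cong; cong₂; sym; trans; subst; module ≡-Reasoning)
open import Relation.Binary.Definitions using (tri<; tri≈; tri>)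
open import Function using (_∘_)
open import Function.Definitions using (Injective)

∣_∣ : ∀ {k} {P : Pred (Fin k) 0ℓ} → Decidable P → ℕ
∣_∣ {k} {P} P? = count k P P?

count-mono : ∀ {k} {P Q : Pred (Fin k) 0ℓ} (P? : Decidable P) (Q? : Decidable Q) →
  P ⊆ Q → ∣ P? ∣ ≤ ∣ Q? ∣
count-mono {zero}  P? Q? P⊆Q = z≤n
count-mono {suc k} P? Q? P⊆Q with P? zero | Q? zero
... | yes _  | yes _  = s≤s (count-mono (P? ∘ suc) (Q? ∘ suc) P⊆Q)
... | yes p  | no ¬q  = ⊥-elim (¬q (P⊆Q p))
... | no _   | yes _  = m≤n⇒m≤1+n (count-mono (P? ∘ suc) (Q? ∘ suc) P⊆Q)
... | no _   | no _   = count-mono (P? ∘ suc) (Q? ∘ suc) P⊆Q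

count-cong : ∀ {k} {P Q : Pred (Fin k) 0ℓ} (P? : Decidable P) (Q? : Decidable Q) →
  P ⊆ Q → Q ⊆ P → ∣ P? ∣ ≡ ∣ Q? ∣
count-cong P? Q? P⊆Q Q⊆P = ≤-antisym (count-mono P? Q? P⊆Q) (count-mono Q? P? Q⊆P)

count-strict : ∀ {k} {P Q : Pred (Fin k) 0ℓ} (P? : Decidable P) (Q? : Decidable Q) →
  P ⊆ Q → ∀ {u} → ¬ P u → Q u → ∣ P? ∣ < ∣ Q? ∣
count-strict {suc k} P? Q? P⊆Q {zero} ¬pu qu with P? zero | Q? zero
... | yes p | _     = ⊥-elim (¬pu p)
... | no _  | yes _ = s≤s (count-mono (P? ∘ suc) (Q? ∘ suc) P⊆Q)
... | no _  | no ¬q = ⊥-elim (¬q qu)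
count-strict {suc k} P? Q? P⊆Q {suc u} ¬pu qu with P? zero | Q? zero
... | yes _ | yes _ = s≤s (count-strict (P? ∘ suc) (Q? ∘ suc) P⊆Q ¬pu qu)
... | yes p | no ¬q = ⊥-elim (¬q (P⊆Q p))
... | no _  | yes _ = m≤n⇒m≤1+n (count-strict (P? ∘ suc) (Q? ∘ suc) P⊆Q ¬pu qu)
... | no _  | no _  = count-strict (P? ∘ suc) (Q? ∘ suc) P⊆Q ¬pu qu

count-all : ∀ k → ∣ U? {A = Fin k} ∣ ≡ k
count-all zero    = refl
count-all (suc k) = cong suc (count-all k)

count-split : ∀ {k} {P Q : Pred (Fin k) 0ℓ} (P? : Decidable P) (Q? : Decidable Q) →
  ∣ P? ∣ ≡ ∣ P? ∩? Q? ∣ + ∣ P? ∩? ∁? Q? ∣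
count-split {zero}  P? Q? = refl
count-split {suc k} P? Q? with P? zero | Q? zero
... | yes _ | yes _ = cong suc (count-split (P? ∘ suc) (Q? ∘ suc))
... | yes _ | no _  = trans (cong suc (count-split (P? ∘ suc) (Q? ∘ suc))) (sym (+-suc _ _))
... | no _  | yes _ = count-split (P? ∘ suc) (Q? ∘ suc)
... | no _  | no _  = count-split (P? ∘ suc) (Q? ∘ suc)

count-complement : ∀ {k} {P : Pred (Fin k) 0ℓ} (P? : Decidable P) → ∣ P? ∣ + ∣ ∁? P? ∣ ≡ k
count-complement {zero}  P? = refl
count-complement {suc k} P? with P? zero
... | yes _ = cong suc (count-complement (P? ∘ suc))
... | no _  = trans (+-suc _ _) (cong suc (count-complement (P? ∘ suc)))

record Enumeration {k : ℕ} (P : Pred (Fin k) 0ℓ) (m : ℕ) : Set where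
  field
    elem      : Fin m → Fin k
    injective : Injective _≡_ _≡_ elem
    late      : ∀ j → toℕ j ≤ toℕ (elem j)
    inside    : ∀ j → P (elem j)
open Enumeration public

empty-enumeration : ∀ {k} {P : Pred (Fin k) 0ℓ} → Enumeration P 0
empty-enumeration = record { elem = λ () ; injective = λ {} ; late = λ () ; inside = λ () }

module _ {k : ℕ} {P : Pred (Fin (suc k)) 0ℓ} where

  shift : ∀ {m} → Enumeration (P ∘ suc) m → Enumeration P m
  shift E = record
    { elem      = suc ∘ elem E
    ; injective = injective E ∘ Finₚ.suc-injective
    ; late      = λ j → m≤n⇒m≤1+n (late E j)
    ; inside    = inside E
    }

  cons : ∀ {m} → P zero → Enumeration (P ∘ suc) m → Enumeration P (suc m)
  cons p E = record { elem = e ; injective = e-inj ; late = e-late ; inside = e-in }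
    where
    e : Fin (suc _) → Fin (suc k)
    e zero    = zero
    e (suc j) = suc (elem E j)
    e-inj : Injective _≡_ _≡_ e
    e-inj {zero}  {zero}  _  = refl
    e-inj {suc i} {suc j} eq = cong suc (injective E (Finₚ.suc-injective eq))
    e-inj {zero}  {suc _} ()
    e-inj {suc _} {zero}  ()
    e-late : ∀ j → toℕ j ≤ toℕ (e j)
    e-late zero    = z≤n
    e-late (suc j) = s≤s (late E j)
    e-in : ∀ j → P (e j)
    e-in zero    = p
    e-in (suc j) = inside E j

select : ∀ {k} {P : Pred (Fin k) 0ℓ} (P? : Decidable P) {m} → m ≤ ∣ P? ∣ → Enumeration P m
select {zero}  P? z≤n = empty-enumeration
select {suc k} P? {m} m≤∣P∣ with P? zero | m
... | yes _ | zero  = empty-enumeration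
... | yes p | suc m = cons p (select (P? ∘ suc) (≤-pred m≤∣P∣))
... | no _  | _     = shift (select (P? ∘ suc) m≤∣P∣)

count-≤-unless-enumeration : ∀ {k} {P : Pred (Fin k) 0ℓ} (P? : Decidable P) {b} →
  ¬ Enumeration P (suc b) → ∣ P? ∣ ≤ b
count-≤-unless-enumeration P? {b} no-enum with ∣ P? ∣ ≤? b
... | yes ∣P∣≤b = ∣P∣≤b
... | no  ∣P∣≰b = ⊥-elim (no-enum (select P? (≰⇒> ∣P∣≰b)))

witness : ∀ {k} {P : Pred (Fin k) 0ℓ} (P? : Decidable P) → 0 < ∣ P? ∣ → ∃ P
witness P? 0<∣P∣ = let E = select P? 0<∣P∣ in elem E zero , inside E zero

count-punchIn : ∀ {k} {P : Pred (Fin (suc k)) 0ℓ} (P? : Decidable P) (v : Fin (suc k)) →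
  ¬ P v → ∣ (λ j → P? (punchIn v j)) ∣ ≡ ∣ P? ∣
count-punchIn P? zero ¬pv with P? zero
... | yes pv = ⊥-elim (¬pv pv)
... | no _   = refl
count-punchIn {suc k} P? (suc v) ¬pv with P? zero
... | yes _ = cong suc (count-punchIn (P? ∘ suc) v ¬pv)
... | no _  = count-punchIn (P? ∘ suc) v ¬pv

module Rank {k : ℕ} {P : Pred (Fin k) 0ℓ} (P? : Decidable P) where

  rank : Fin k → ℕ
  rank u = ∣ P? ∩? (Finₚ._<? u) ∣

  rank-<-size : ∀ {u} → P u → rank u < ∣ P? ∣
  rank-<-size {u} pu = count-strict (P? ∩? (Finₚ._<? u)) P? proj₁ (λ (_ , u<u) → <-irrefl refl u<u) pu

  rank-strictly-monotone : ∀ {u w} → P u → u Fin.< w → rank u < rank w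
  rank-strictly-monotone {u} {w} pu u<w =
    count-strict (P? ∩? (Finₚ._<? u)) (P? ∩? (Finₚ._<? w)) (λ (px , x<u) → px , <-trans x<u u<w)
                 (λ (_ , u<u) → <-irrefl refl u<u) (pu , u<w)

  rank-injective : ∀ {u w} → P u → P w → rank u ≡ rank w → u ≡ w
  rank-injective {u} {w} pu pw eq with <-cmp (toℕ u) (toℕ w)
  ... | tri< u<w _ _ = ⊥-elim (<-irrefl eq (rank-strictly-monotone pu u<w))
  ... | tri≈ _ u≡w _ = Finₚ.toℕ-injective u≡w
  ... | tri> _ _ w<u = ⊥-elim (<-irrefl (sym eq) (rank-strictly-monotone pw w<u))

partition-embedding : ∀ {k} {P : Pred (Fin k) 0ℓ} (P? : Decidable P) →
  Σ (Fin k → Fin k) λ ρ → Injective _≡_ _≡_ ρ × (∀ {u} → P u → ∣ ∁? P? ∣ ≤ toℕ (ρ u))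
partition-embedding {k} {P} P? = ρ , ρ-injective , ρ-late
  where
  module In  = Rank P?
  module Out = Rank (∁? P?)

  outside : ℕ
  outside = ∣ ∁? P? ∣

  position : (u : Fin k) → Dec (P u) → ℕ
  position u (yes _) = outside + In.rank u
  position u (no _)  = Out.rank u

  position-< : ∀ u (d : Dec (P u)) → position u d < k
  position-< u (yes pu) = begin-strict
    outside + In.rank u  <⟨ +-monoʳ-< outside (In.rank-<-size pu) ⟩
    outside + ∣ P? ∣     ≡⟨ +-comm outside _ ⟩
    ∣ P? ∣ + outside     ≡⟨ count-complement P? ⟩
    k                    ∎
    where open ≤-Reasoning
  position-< u (no ¬pu) = ≤-trans (Out.rank-<-size ¬pu)
    (subst (outside ≤_) (count-complement P?) (m≤n+m outside _))

  position-injective : ∀ {u w} (du : Dec (P u)) (dw : Dec (P w)) →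
    position u du ≡ position w dw → u ≡ w
  position-injective (yes pu)  (yes pw)  eq = In.rank-injective pu pw (+-cancelˡ-≡ outside _ _ eq)
  position-injective (no ¬pu)  (no ¬pw)  eq = Out.rank-injective ¬pu ¬pw eq
  position-injective (yes _)   (no ¬pw)  eq =
    ⊥-elim (<⇒≱ (Out.rank-<-size ¬pw) (subst (outside ≤_) eq (m≤m+n outside _)))
  position-injective (no ¬pu)  (yes _)   eq =
    ⊥-elim (<⇒≱ (Out.rank-<-size ¬pu) (subst (outside ≤_) (sym eq) (m≤m+n outside _)))

  ρ : Fin k → Fin k
  ρ u = fromℕ< (position-< u (P? u))

  toℕ-ρ : ∀ u → toℕ (ρ u) ≡ position u (P? u)
  toℕ-ρ u = Finₚ.toℕ-fromℕ< (position-< u (P? u))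

  ρ-injective : Injective _≡_ _≡_ ρ
  ρ-injective {u} {w} eq =
    position-injective (P? u) (P? w) (trans (sym (toℕ-ρ u)) (trans (cong toℕ eq) (toℕ-ρ w)))

  position-late : ∀ {u} → P u → (d : Dec (P u)) → outside ≤ position u d
  position-late _  (yes _)  = m≤m+n outside _
  position-late pu (no ¬pu) = ⊥-elim (¬pu pu)

  ρ-late : ∀ {u} → P u → outside ≤ toℕ (ρ u)
  ρ-late {u} pu = subst (outside ≤_) (sym (toℕ-ρ u)) (position-late pu (P? u))

window-pigeonhole : ∀ {a} (g : Fin a → ℕ) → Injective _≡_ _≡_ g → ∀ lo b →
  (∀ j → lo ≤ g j × g j < lo + b) → a ≤ b
window-pigeonhole g g-inj lo b window = Finₚ.injective⇒≤ offset-injective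
  where
  offset< : ∀ j → g j ∸ lo < b
  offset< j = subst (g j ∸ lo <_) (m+n∸m≡n lo b)
                    (∸-monoˡ-< (proj₂ (window j)) (proj₁ (window j)))

  toℕ-offset : ∀ j → toℕ (fromℕ< (offset< j)) ≡ g j ∸ lo
  toℕ-offset j = Finₚ.toℕ-fromℕ< (offset< j)

  offset-injective : Injective _≡_ _≡_ (λ j → fromℕ< (offset< j))
  offset-injective {i} {j} eq = g-inj (∸-cancelʳ-≡ (proj₁ (window i)) (proj₁ (window j))
    (trans (sym (toℕ-offset i)) (trans (cong toℕ eq) (toℕ-offset j))))

RainbowSet : ∀ {V : Set} → (V → ℕ) → Pred V 0ℓ → Set
RainbowSet c A = ∀ {x y} → A x → A y → x ≢ y → c x ≢ c y

few-colours : ∀ {V : Set} {a b} (c : V → ℕ) (f : Fin a → V) →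
  (∀ x → c x < b) → Rainbow c f → a ≤ b
few-colours {b = b} c f c<b rainbow =
  window-pigeonhole (c ∘ f) colour-injective 0 b (λ j → z≤n , c<b (f j))
  where
  colour-injective : Injective _≡_ _≡_ (c ∘ f)
  colour-injective {i} {j} eq with i Finₚ.≟ j
  ... | yes i≡j = i≡j
  ... | no i≢j  = ⊥-elim (rainbow i j i≢j eq)

CopyIn : ∀ {n} → Graph n → (V : Set) → (V → V → Set) → Pred V 0ℓ → Set
CopyIn F V GAdj A = Σ (Copy F V GAdj) λ C → ∀ u → A (proj₁ C u)

module WormCopies {n} {F : Graph n} {V : Set} (GAdj : V → V → Set) (c : V → ℕ)
                  (W : IsWORM F V GAdj c) where

  worm-no-mono-copy : ∀ {A : Pred V 0ℓ} {a} → (∀ {x} → A x → c x ≡ a) → ¬ CopyIn F V GAdj A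
  worm-no-mono-copy constant (C , inside) =
    proj₁ (W C) (λ i j → trans (constant (inside i)) (sym (constant (inside j))))

  worm-no-rainbow-copy : ∀ {A : Pred V 0ℓ} → RainbowSet c A → ¬ CopyIn F V GAdj A
  worm-no-rainbow-copy rainbow (C@(_ , C-injective , _) , inside) =
    proj₂ (W C) (λ i j i≢j → rainbow (inside i) (inside j) (i≢j ∘ C-injective))

module RainbowSubsets {N : ℕ} (colour : Fin N → ℕ) where

  Class : ℕ → Pred (Fin N) 0ℓ
  Class a i = colour i ≡ a

  class? : ∀ a → Decidable (Class a)
  class? a i = colour i ≟ a

  record RainbowSubset (Q : Pred (Fin N) 0ℓ) (t : ℕ) : Set₁ where
    field
      members  : Pred (Fin N) 0ℓ
      members? : Decidable members
      within   : members ⊆ Q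
      rainbow  : RainbowSet colour members
      large    : t ≤ ∣ members? ∣
  open RainbowSubset

  empty-rainbow : ∀ {Q} → RainbowSubset Q 0
  empty-rainbow = record
    { members = ∅ ; members? = ∅? ; within = λ () ; rainbow = λ () ; large = z≤n }

  enlarge : ∀ {Q Q' t} → Q ⊆ Q' → RainbowSubset Q t → RainbowSubset Q' t
  enlarge Q⊆Q' R = record
    { members = members R ; members? = members? R ; within = Q⊆Q' ∘ within R
    ; rainbow = rainbow R ; large = large R }

  adjoin : ∀ {Q t u} (R : RainbowSubset Q t) → Q u →
    (∀ {i} → members R i → colour i ≢ colour u) → RainbowSubset Q (suc t)
  adjoin {u = u} R qu new = record
    { members  = members R ∪ ｛ u ｝
    ; members? = members? R ∪? (u Finₚ.≟_)
    ; within   = λ { (inj₁ ri) → within R ri ; (inj₂ refl) → qu }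
    ; rainbow  = rainbow′
    ; large    = ≤-trans (s≤s (large R))
                   (count-strict (members? R) (members? R ∪? (u Finₚ.≟_)) inj₁
                                 (λ ru → new ru refl) (inj₂ refl))
    }
    where
    rainbow′ : RainbowSet colour (members R ∪ ｛ u ｝)
    rainbow′ (inj₁ ri) (inj₁ rj) i≢j = rainbow R ri rj i≢j
    rainbow′ (inj₁ ri) (inj₂ refl) _ = new ri
    rainbow′ (inj₂ refl) (inj₁ rj) _ = new rj ∘ sym
    rainbow′ (inj₂ refl) (inj₂ refl) u≢u = ⊥-elim (u≢u refl)

  -- Pick any
  -- u ∈ Q; discarding the class of u leaves more than (t - 1)·b elements.
  module _ {b : ℕ} (class-bound : ∀ a → ∣ class? a ∣ ≤ b) where

    rainbow-subset : ∀ t {Q} (Q? : Decidable Q) → t * b < ∣ Q? ∣ → RainbowSubset Q (suc t)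
    rainbow-subset t {Q} Q? t*b<∣Q∣ = adjoin (enlarge proj₁ rest) (proj₂ member)
                                             (λ ri → proj₂ (within rest ri))
      where
      member : ∃ Q
      member = witness Q? (≤-trans (s≤s z≤n) t*b<∣Q∣)

      u : Fin N
      u = proj₁ member

      Q′? : Decidable (Q ∩ ∁ (Class (colour u)))
      Q′? = Q? ∩? ∁? (class? (colour u))

      |Q|≤b+|Q′| : ∣ Q? ∣ ≤ b + ∣ Q′? ∣
      |Q|≤b+|Q′| = begin
        ∣ Q? ∣                                             ≡⟨ count-split Q? (class? (colour u)) ⟩
        ∣ Q? ∩? class? (colour u) ∣ + ∣ Q′? ∣              ≤⟨ +-monoˡ-≤ _ (≤-trans
            (count-mono (Q? ∩? class? (colour u)) (class? (colour u)) proj₂)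
            (class-bound (colour u))) ⟩
        b + ∣ Q′? ∣                                        ∎
        where open ≤-Reasoning

      smaller : ∀ t → t * b < ∣ Q? ∣ → RainbowSubset (Q ∩ ∁ (Class (colour u))) t
      smaller zero     _           = empty-rainbow
      smaller (suc t′) t′b+b<∣Q∣ = rainbow-subset t′ Q′?
        (+-cancelˡ-< b _ _ (<-≤-trans t′b+b<∣Q∣ |Q|≤b+|Q′|))

      rest : RainbowSubset (Q ∩ ∁ (Class (colour u))) t
      rest = smaller t t*b<∣Q∣

-- Deciding adjacency to v; with this decision procedure |adjacent? F v| is
-- literally degree F v.
adjacent? : ∀ {n} (F : Graph n) (v : Fin n) → Decidable (λ u → adj F v u ≡ true)
adjacent? F v u = adj F v u Bool.≟ true

adjacent⇒≢ : ∀ {n} (F : Graph n) {u w} → adj F u w ≡ true → u ≢ w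
adjacent⇒≢ F {u} uw refl with () ← trans (sym uw) (irrefl F u)

degree<order : ∀ {n} (F : Graph n) v → degree F v < n
degree<order {n} F v = subst (degree F v <_) (count-all n)
  (count-strict (adjacent? F v) U? (λ _ → tt) (λ vv → adjacent⇒≢ F vv refl) tt)

inner-count : ∀ p → suc (innerCount (2 + p)) ≡ suc p * suc p
inner-count p = cong (suc p *_) (*-identityʳ (suc p))

size-S′ : ∀ m δ → suc m ∸ δ ∸ 1 ≡ m ∸ δ
size-S′ m δ = trans (∸-+-assoc (suc m) δ 1) (cong (suc m ∸_) (+-comm δ 1))

module Copies {m : ℕ} (F : Graph (suc m)) (δ : ℕ) where

  n N : ℕ
  n = suc m
  N = innerCount n

  V : Set
  V = G1V n

  _~_ : V → V → Set
  _~_ = G1Adj n δ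

  -- Inner vertices form a clique: any n of them carry a copy of F.
  clique-copy : ∀ {Q} → Enumeration Q n → CopyIn F V _~_ (Q ⟨⊎⟩ ∅)
  clique-copy E = (inj₁ ∘ elem E , injective E ∘ inj₁-injective , edge) , inside E
    where
    edge : ∀ u w → adj F u w ≡ true → inj₁ (elem E u) ~ inj₁ (elem E w)
    edge u w uw = adjacent⇒≢ F uw ∘ injective E

  -- A vertex v of degree δ can be sent to an outer vertex o, provided the
  -- other m vertices go to m inner vertices listed by an enumeration: order the
  -- other vertices non-neighbours first; since the enumeration never moves an
  -- index down, the δ neighbours of v land on positions ≥ |S'|, i.e. in S.
  outer-copy : ∀ {Q} (v : Fin n) → degree F v ≡ δ → (o : Bool) →
    Enumeration Q m → CopyIn F V _~_ (Q ⟨⊎⟩ ｛ o ｝)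
  outer-copy {Q} v deg-v o E = ((λ u → place u (v Finₚ.≟ u)) , place-injective _ _ , edge)
                             , λ u → place-inside u (v Finₚ.≟ u)
    where
    Nbr? : Decidable (λ j → adj F v (punchIn v j) ≡ true)
    Nbr? j = adjacent? F v (punchIn v j)

    non-neighbours : ∣ ∁? Nbr? ∣ ≡ n ∸ δ ∸ 1
    non-neighbours = begin
      ∣ ∁? Nbr? ∣                    ≡⟨ sym (m+n∸m≡n ∣ Nbr? ∣ _) ⟩
      ∣ Nbr? ∣ + ∣ ∁? Nbr? ∣ ∸ ∣ Nbr? ∣ ≡⟨ cong₂ _∸_ (count-complement Nbr?) number-of-neighbours ⟩
      m ∸ δ                          ≡⟨ sym (size-S′ m δ) ⟩
      n ∸ δ ∸ 1                      ∎
      where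
      open ≡-Reasoning
      number-of-neighbours : ∣ Nbr? ∣ ≡ δ
      number-of-neighbours =
        trans (count-punchIn (adjacent? F v) v (λ vv → adjacent⇒≢ F vv refl)) deg-v

    ρ : Fin m → Fin m
    ρ = proj₁ (partition-embedding Nbr?)

    ρ-injective : Injective _≡_ _≡_ ρ
    ρ-injective = proj₁ (proj₂ (partition-embedding Nbr?))

    ρ-late : ∀ {j} → adj F v (punchIn v j) ≡ true → ∣ ∁? Nbr? ∣ ≤ toℕ (ρ j)
    ρ-late = proj₂ (proj₂ (partition-embedding Nbr?))

    slot : ∀ {u} → v ≢ u → Fin N
    slot v≢u = elem E (ρ (punchOut v≢u))

    slot-injective : ∀ {u w} (v≢u : v ≢ u) (v≢w : v ≢ w) → slot v≢u ≡ slot v≢w → u ≡ w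
    slot-injective v≢u v≢w =
      Finₚ.punchOut-injective v≢u v≢w ∘ ρ-injective ∘ injective E

    slot-in-S : ∀ {u} (v≢u : v ≢ u) → adj F v u ≡ true → InS n δ (slot v≢u)
    slot-in-S v≢u vu = subst (_≤ toℕ (slot v≢u)) non-neighbours
      (≤-trans (ρ-late neighbour) (late E _))
      where
      neighbour : adj F v (punchIn v (punchOut v≢u)) ≡ true
      neighbour = subst (λ w → adj F v w ≡ true) (sym (Finₚ.punchIn-punchOut v≢u)) vu

    place : (u : Fin n) → Dec (v ≡ u) → V
    place u (yes _)   = inj₂ o
    place u (no v≢u)  = inj₁ (slot v≢u)

    place-injective : ∀ {u w} (du : Dec (v ≡ u)) (dw : Dec (v ≡ w)) →
      place u du ≡ place w dw → u ≡ w
    place-injective (yes v≡u) (yes v≡w) _  = trans (sym v≡u) v≡w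
    place-injective (no v≢u)  (no v≢w)  eq = slot-injective v≢u v≢w (inj₁-injective eq)
    place-injective (yes _) (no _) ()
    place-injective (no _) (yes _) ()

    place-edge : ∀ {u w} → adj F u w ≡ true →
      (du : Dec (v ≡ u)) (dw : Dec (v ≡ w)) → place u du ~ place w dw
    place-edge vw (yes refl) (yes refl) = adjacent⇒≢ F vw refl
    place-edge vw (yes refl) (no v≢w)   = slot-in-S v≢w vw
    place-edge {u} uv (no v≢u) (yes refl) = slot-in-S v≢u (trans (Graph.sym F v u) uv)
    place-edge uw (no v≢u) (no v≢w)     = adjacent⇒≢ F uw ∘ slot-injective v≢u v≢w

    edge : ∀ u w → adj F u w ≡ true → place u (v Finₚ.≟ u) ~ place w (v Finₚ.≟ w)
    edge u w uw = place-edge uw (v Finₚ.≟ u) (v Finₚ.≟ w)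

    place-inside : ∀ u (du : Dec (v ≡ u)) → (Q ⟨⊎⟩ ｛ o ｝) (place u du)
    place-inside u (yes _)  = refl
    place-inside u (no v≢u) = inside E _

quotient-window : ∀ x m .{{_ : NonZero m}} → (x / m) * m ≤ x × x < (x / m) * m + m
quotient-window x m = m/n*n≤m x m , (begin-strict
  x                      ≡⟨ m≡m%n+[m/n]*n x m ⟩
  x % m + (x / m) * m    <⟨ +-monoˡ-< _ (m%n<n x m) ⟩
  m + (x / m) * m        ≡⟨ +-comm m _ ⟩
  (x / m) * m + m        ∎)
  where open ≤-Reasoning

-- The S-vertices of colour 0 (in the colouring below) have positions i + 1 in [|S'| + 1, n - 1),
-- a window of length δ - 1: |S'| + 1 + (δ - 1) = n - 1.
S-window-length : ∀ m δ → 1 ≤ δ → δ ≤ m → suc (suc m ∸ δ ∸ 1) + pred δ ≡ m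
S-window-length m (suc d) _ δ≤m = begin
  suc (suc m ∸ suc d ∸ 1) + d  ≡⟨ cong (λ x → suc x + d) (size-S′ m (suc d)) ⟩
  suc (m ∸ suc d) + d          ≡⟨ sym (+-suc _ d) ⟩
  (m ∸ suc d) + suc d          ≡⟨ m∸n+n≡m δ≤m ⟩
  m                            ∎
  where open ≡-Reasoning

module Existence {p : ℕ} (F : Graph (2 + p)) (δ : ℕ)
                 (δ≤degree : ∀ u → δ ≤ degree F u) (1≤δ : 1 ≤ δ) where

  open Copies F δ using (n; N; V; _~_)

  m s : ℕ
  m = suc p
  s = n ∸ δ ∸ 1

  colouring : V → ℕ
  colouring (inj₁ i) = suc (toℕ i) / m
  colouring (inj₂ _) = 0

  colouring-< : ∀ x → colouring x < m
  colouring-< (inj₁ i) = m<n*o⇒m/o<n (subst (suc (toℕ i) <_) (inner-count p) (s≤s (Finₚ.toℕ<n i)))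
  colouring-< (inj₂ _) = s≤s z≤n

  colour-window : ∀ {i κ} → colouring (inj₁ i) ≡ κ → κ * m ≤ suc (toℕ i) × suc (toℕ i) < κ * m + m
  colour-window {i} refl = quotient-window (suc (toℕ i)) m

  positions-injective : ∀ {a} (h : Fin a → V) → Injective _≡_ _≡_ h →
    (index : ∀ j → Σ (Fin N) λ i → h j ≡ inj₁ i) →
    Injective _≡_ _≡_ (λ j → suc (toℕ (proj₁ (index j))))
  positions-injective h h-inj index {j} {j′} eq = h-inj (begin
    h j                     ≡⟨ proj₂ (index j) ⟩
    inj₁ (proj₁ (index j))  ≡⟨ cong inj₁ (Finₚ.toℕ-injective (suc-injective eq)) ⟩
    inj₁ (proj₁ (index j′)) ≡⟨ sym (proj₂ (index j′)) ⟩
    h j′                    ∎)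
    where open ≡-Reasoning

  outer-neighbour : ∀ {b} x → inj₂ b ~ x → Σ (Fin N) λ i → x ≡ inj₁ i × InS n δ i
  outer-neighbour (inj₁ i) i∈S = i , refl , i∈S

  S-window : suc s + pred δ ≡ m
  S-window = S-window-length m δ 1≤δ (≤-pred (≤-<-trans (δ≤degree zero) (degree<order F zero)))

  module MonochromaticCopy (f : Fin n → V) (f-injective : Injective _≡_ _≡_ f)
                           (f-edge : ∀ u w → adj F u w ≡ true → f u ~ f w)
                           (mono : Monochromatic colouring f) where

    -- Some vertex u of F on an outer vertex forces colour 0, and then u's δ
    -- neighbours would fit into a window of length δ - 1.
    mono-avoids-outer : ∀ u b → f u ≢ inj₂ b
    mono-avoids-outer u b fu≡b = 1+n≰n (subst (_≤ pred δ) (sym (suc-pred δ {{>-nonZero 1≤δ}}))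
      (window-pigeonhole _ (positions-injective (f ∘ elem E) (injective E ∘ f-injective) index)
                         (suc s) (pred δ) window))
      where
      E : Enumeration (λ w → adj F u w ≡ true) δ
      E = select (adjacent? F u) (δ≤degree u)

      neighbour : ∀ j → Σ (Fin N) λ i → f (elem E j) ≡ inj₁ i × InS n δ i
      neighbour j = outer-neighbour _ (subst (_~ f (elem E j)) fu≡b (f-edge u _ (inside E j)))

      index : ∀ j → Σ (Fin N) λ i → f (elem E j) ≡ inj₁ i
      index j = proj₁ (neighbour j) , proj₁ (proj₂ (neighbour j))

      colour-0 : ∀ j → colouring (inj₁ (proj₁ (neighbour j))) ≡ 0
      colour-0 j = trans (cong colouring (sym (proj₁ (proj₂ (neighbour j)))))
                         (trans (mono (elem E j) u) (cong colouring fu≡b))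

      window : ∀ j → suc s ≤ suc (toℕ (proj₁ (neighbour j)))
                   × suc (toℕ (proj₁ (neighbour j))) < suc s + pred δ
      window j = s≤s (proj₂ (proj₂ (neighbour j)))
               , subst (suc (toℕ (proj₁ (neighbour j))) <_) (sym S-window)
                       (proj₂ (colour-window (colour-0 j)))

    -- So all n vertices are inner vertices of one colour class of size ≤ m.
    no-mono : ⊥
    no-mono = 1+n≰n (window-pigeonhole _ (positions-injective f f-injective index)
                                        (κ * m) m window)
      where
      index : ∀ u → Σ (Fin N) λ i → f u ≡ inj₁ i
      index u with f u in fu≡
      ... | inj₁ i = i , refl
      ... | inj₂ b = ⊥-elim (mono-avoids-outer u b fu≡)

      κ : ℕ
      κ = colouring (f zero)

      window : ∀ u → κ * m ≤ suc (toℕ (proj₁ (index u))) × suc (toℕ (proj₁ (index u))) < κ * m + m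
      window u = colour-window (trans (cong colouring (sym (proj₂ (index u)))) (mono u zero))

  worm : IsWORM F V _~_ colouring
  worm (f , f-injective , f-edge) =
      MonochromaticCopy.no-mono f f-injective f-edge
    , λ rainbow → 1+n≰n (few-colours colouring f colouring-< rainbow)

excess : ∀ {A B X y} → A + B ≡ X + y → A ≤ y → X ≤ B
excess {A} {B} {X} {y} eq A≤y = +-cancelʳ-≤ y X B (begin
  X + y  ≡⟨ sym eq ⟩
  A + B  ≤⟨ +-monoˡ-≤ B A≤y ⟩
  y + B  ≡⟨ +-comm y B ⟩
  B + y  ∎)
  where open ≤-Reasoning

-- Necessity, for n = k + 3 and m = n - 1 = k + 2, and any vertex v of F whose
-- degree is the parameter δ of G₁(F).  Let c be an F-WORM colouring.
--   * On the inner clique, colour classes and rainbow sets have ≤ m vertices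
--     (otherwise n of them carry a monochromatic or rainbow clique copy).
--   * Putting v on an outer vertex o, the class of c(o) and the rainbow sets
--     avoiding c(o) have ≤ m - 1 inner vertices (outer-copy).
--   * Greedy selection then shows the class of c(o) has exactly m - 1 = n - 2
--     inner vertices; if c(x) ≠ c(y), the remaining (m - 2)·m + 1 inner vertices
--     give a rainbow set of size m - 1, which extends by one vertex of colour
--     c(x) and one of colour c(y) to a rainbow set of size m + 1.
module Necessity {k : ℕ} (F : Graph (3 + k)) (δ : ℕ) (v : Fin (3 + k)) (degree-v : degree F v ≡ δ)
                 (c : G1V (3 + k) → ℕ) (W : IsWORM F (G1V (3 + k)) (G1Adj (3 + k) δ) c) where

  open Copies F δ
  open WormCopies {F = F} _~_ c W

  m : ℕ
  m = suc (suc k)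

  colour : Fin N → ℕ
  colour i = c (inj₁ i)

  open RainbowSubsets colour
  open RainbowSubset

  -- N = (m - 1)·m + 1 + (m - 2) = 2(m - 1) + (m - 2)·m + 1
  N-for-own-class : N ≡ suc (suc k * m) + k
  N-for-own-class = suc-injective (trans (inner-count (suc k)) (square k))
    where
    square : ∀ k → suc (suc k) * suc (suc k) ≡ suc (suc (suc k * suc (suc k)) + k)
    square = solve-∀

  N-for-two-classes : N ≡ (suc k + suc k) + suc (k * m)
  N-for-two-classes = suc-injective (trans (inner-count (suc k)) (square k))
    where
    square : ∀ k → suc (suc k) * suc (suc k) ≡ suc ((suc k + suc k) + suc (k * suc (suc k)))
    square = solve-∀

  -- n inner vertices of one colour would carry a monochromatic copy
  class-bound : ∀ a → ∣ class? a ∣ ≤ m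
  class-bound a = count-≤-unless-enumeration (class? a) λ E →
    worm-no-mono-copy constant (clique-copy E)
    where
    constant : ∀ {x} → (Class a ⟨⊎⟩ ∅) x → c x ≡ a
    constant {inj₁ i} i∈a = i∈a

  -- n inner vertices of distinct colours would carry a rainbow copy
  rainbow-bound : ∀ {R} (R? : Decidable R) → RainbowSet colour R → ∣ R? ∣ ≤ m
  rainbow-bound {R} R? rainbow = count-≤-unless-enumeration R? λ E →
    worm-no-rainbow-copy lifted (clique-copy E)
    where
    lifted : RainbowSet c (R ⟨⊎⟩ ∅)
    lifted {inj₁ i} {inj₁ j} ri rj x≢y = rainbow ri rj (x≢y ∘ cong inj₁)

  -- m inner vertices of colour c(o), with o, would carry a monochromatic copy
  outer-class-bound : ∀ o → ∣ class? (c (inj₂ o)) ∣ ≤ suc k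
  outer-class-bound o = count-≤-unless-enumeration (class? (c (inj₂ o))) λ E →
    worm-no-mono-copy constant (outer-copy v degree-v o E)
    where
    constant : ∀ {x} → (Class (c (inj₂ o)) ⟨⊎⟩ ｛ o ｝) x → c x ≡ c (inj₂ o)
    constant {inj₁ i} i∈class = i∈class
    constant {inj₂ _} refl    = refl

  -- m inner vertices of distinct colours other than c(o), with o, would carry
  -- a rainbow copy
  outer-rainbow-bound : ∀ o {R} (R? : Decidable R) → RainbowSet colour R →
    R ⊆ ∁ (Class (c (inj₂ o))) → ∣ R? ∣ ≤ suc k
  outer-rainbow-bound o {R} R? rainbow avoids = count-≤-unless-enumeration R? λ E →
    worm-no-rainbow-copy lifted (outer-copy v degree-v o E)
    where
    lifted : RainbowSet c (R ⟨⊎⟩ ｛ o ｝)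
    lifted {inj₁ _} {inj₁ _} ri   rj   x≢y = rainbow ri rj (x≢y ∘ cong inj₁)
    lifted {inj₁ _} {inj₂ _} ri   refl _   = avoids ri
    lifted {inj₂ _} {inj₁ _} refl rj   _   = avoids rj ∘ sym
    lifted {inj₂ _} {inj₂ _} refl refl x≢y = ⊥-elim (x≢y refl)

  large-rainbow : ∀ t {Q} (Q? : Decidable Q) → t * m < ∣ Q? ∣ → RainbowSubset Q (suc t)
  large-rainbow = rainbow-subset class-bound

  outer-class-size : ∀ o → ∣ class? (c (inj₂ o)) ∣ ≡ suc k
  outer-class-size o = ≤-antisym (outer-class-bound o) at-least
    where
    a : ℕ
    a = c (inj₂ o)

    at-least : suc k ≤ ∣ class? a ∣
    at-least with suc k ≤? ∣ class? a ∣
    ... | yes enough = enough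
    ... | no  few    = ⊥-elim (1+n≰n (≤-trans (large R)
            (outer-rainbow-bound o (members? R) (rainbow R) (within R))))
      where
      R : RainbowSubset (∁ (Class a)) (suc (suc k))
      R = large-rainbow (suc k) (∁? (class? a))
            (excess (trans (count-complement (class? a)) N-for-own-class) (≤-pred (≰⇒> few)))

  outer-colours-agree : c (inj₂ false) ≡ c (inj₂ true)
  outer-colours-agree with c (inj₂ false) ≟ c (inj₂ true)
  ... | yes a≡b = a≡b
  ... | no  a≢b = ⊥-elim (1+n≰n (≤-trans (large R₂) (rainbow-bound (members? R₂) (rainbow R₂))))
    where
    a b : ℕ
    a = c (inj₂ false)
    b = c (inj₂ true)

    rest? : Decidable (∁ (Class a) ∩ ∁ (Class b))
    rest? = ∁? (class? a) ∩? ∁? (class? b)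

    b-outside-a : ∣ ∁? (class? a) ∩? class? b ∣ ≡ ∣ class? b ∣
    b-outside-a = count-cong (∁? (class? a) ∩? class? b) (class? b) proj₂
      (λ i∈b → (λ i∈a → a≢b (trans (sym i∈a) i∈b)) , i∈b)

    rest-size : (suc k + suc k) + ∣ rest? ∣ ≡ (suc k + suc k) + suc (k * m)
    rest-size = begin
      (suc k + suc k) + ∣ rest? ∣                              ≡⟨ +-assoc (suc k) (suc k) _ ⟩
      suc k + (suc k + ∣ rest? ∣)                              ≡⟨ cong₂ (λ x y → x + (y + ∣ rest? ∣))
                                                                  (sym (outer-class-size false))
                                                                  (sym (trans b-outside-a (outer-class-size true))) ⟩
      ∣ class? a ∣ + (∣ ∁? (class? a) ∩? class? b ∣ + ∣ rest? ∣) ≡⟨ cong (∣ class? a ∣ +_)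
                                                                  (sym (count-split (∁? (class? a)) (class? b))) ⟩
      ∣ class? a ∣ + ∣ ∁? (class? a) ∣                          ≡⟨ count-complement (class? a) ⟩
      N                                                        ≡⟨ N-for-two-classes ⟩
      (suc k + suc k) + suc (k * m)                            ∎
      where open ≡-Reasoning

    R : RainbowSubset (∁ (Class a) ∩ ∁ (Class b)) (suc k)
    R = large-rainbow k rest? (≤-reflexive (sym (+-cancelˡ-≡ (suc k + suc k) _ _ rest-size)))

    member-of : ∀ o → ∃ (Class (c (inj₂ o)))
    member-of o = witness (class? (c (inj₂ o))) (subst (0 <_) (sym (outer-class-size o)) (s≤s z≤n))

    ua ub : Fin N
    ua = proj₁ (member-of false)
    ub = proj₁ (member-of true)

    ua∈a : colour ua ≡ a
    ua∈a = proj₂ (member-of false)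

    ub∈b : colour ub ≡ b
    ub∈b = proj₂ (member-of true)

    R₁ : RainbowSubset U (suc (suc k))
    R₁ = adjoin (enlarge (λ _ → tt) R) tt (λ ri same → proj₁ (within R ri) (trans same ua∈a))

    R₂ : RainbowSubset U (suc (suc (suc k)))
    R₂ = adjoin R₁ tt new-b
      where
      new-b : ∀ {i} → members R₁ i → colour i ≢ colour ub
      new-b (inj₁ ri)   same = proj₂ (within R ri) (trans same ub∈b)
      new-b (inj₂ refl) same = a≢b (trans (sym ua∈a) (trans same ub∈b))

order-≥3 : ∀ {n} (F : Graph n) {δ} v → degree F v ≡ δ → 2 ≤ δ → 3 ≤ n
order-≥3 {n} F v degree-v 2≤δ = ≤-trans (s≤s 2≤δ) (subst (_< n) degree-v (degree<order F v))

lemma6 : (n : ℕ) (F : Graph n) (δ : ℕ) → MinDegree F δ → 2 ≤ δ →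
    (∃ λ c → IsWORM F (G1V n) (G1Adj n δ) c) ×
    (∀ c → IsWORM F (G1V n) (G1Adj n δ) c →
      (c (outerX n) ≡ c (outerY n)) ×
      (count (innerCount n) (λ i → c (inj₁ i) ≡ c (outerX n)) (λ i → c (inj₁ i) ≟ c (outerX n)) ≡ n ∸ 2))
lemma6 n F δ (δ≤degree , v , degree-v) 2≤δ with order-≥3 F v degree-v 2≤δ
... | s≤s (s≤s (s≤s _)) =
    (Existence.colouring F δ δ≤degree 1≤δ , Existence.worm F δ δ≤degree 1≤δ)
  , λ c W → let open Necessity F δ v degree-v c W in outer-colours-agree , outer-class-size false
  where
  1≤δ : 1 ≤ δ
  1≤δ = ≤-trans (s≤s z≤n) 2≤δ
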